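{- Let $n\geq 2$ be an integer and let $S$ be a sequence in $\mathbb Z_n$. Then $S$ is a $D$-extremal sequence for $(\mathbb Z_n',\{1\})$ if and only if $S$ is a translate of a sequence which is equivalent to the sequence $(0,1)$.
   Context: $\mathbb Z_n=\mathbb Z/n\mathbb Z$ as a module over itself and $\mathbb Z_n'=\mathbb Z_n\setminus\{0\}$. A subsequence is a non-empty subfamily of terms in the original order. For non-empty $A,B\subseteq\mathbb Z_n$, a sequence $(x_1,\ldots,x_k)$ is an $(A,B)$-weighted zero-sum sequence if there exist $a_i\in A$, $b_i\in B$ with $\sum a_ix_i=0$ and $\sum b_ia_i=0$. $D_{A,B}(n)$ is the least positive $k$ such that every sequence of length $k$ in $\mathbb Z_n$ has an $(A,B)$-weighted zero-sum subsequence; a $D$-extremal sequence for $(A,B)$ is a sequence of length $D_{A,B}(n)-1$ having no $(A,B)$-weighted zero-sum subsequence. A translate of $(x_1,\ldots,x_k)$ is $(x_1+x,\ldots,x_k+x)$ for some $x\in\mathbb Z_n$. Sequences $(x_1,\ldots,x_k)$ and $(y_1,\ldots,y_k)$ are equivalent if there exist a permutation $\sigma$ of $[1,k]$ and a unit $u\in\mathbb Z_n$ with $y_{\sigma(i)}=ux_i$ for all $i$. -}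

module Defs where

open import Data.Nat using (ℕ; zero; suc; _+_; _*_; _≤_; _<_; NonZero)
open import Data.Nat.DivMod using (_%_; m%n<n)
open import Data.Nat.Divisibility using (_∣_)
open import Data.Fin using (Fin; toℕ; fromℕ<)
open import Data.List using (List; []; _∷_; length; map; zipWith)
open import Data.Nat.ListAction using (sum)
open import Data.List.Relation.Unary.All using (All)
open import Data.List.Relation.Binary.Sublist.Propositional using (_⊆_)
open import Data.List.Relation.Binary.Permutation.Propositional using (_↭_)
open import Data.Product using (Σ; _×_)
open import Relation.Binary.PropositionalEquality using (_≡_; _≢_)
open import Relation.Nullary using (¬_)
open import Level using (0ℓ)

-- ℤ_n is represented by Fin n (residues 0..n-1); arithmetic is mod n.

addₙ : ∀ {n} .{{_ : NonZero n}} → Fin n → Fin n → Fin n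
addₙ {n} x y = fromℕ< (m%n<n (toℕ x + toℕ y) n)

mulₙ : ∀ {n} .{{_ : NonZero n}} → Fin n → Fin n → Fin n
mulₙ {n} x y = fromℕ< (m%n<n (toℕ x * toℕ y) n)

oneₙ : ∀ {n} .{{_ : NonZero n}} → Fin n
oneₙ {n} = fromℕ< (m%n<n 1 n)

IsUnit : ∀ {n} .{{_ : NonZero n}} → Fin n → Set
IsUnit {n} u = Σ (Fin n) λ v → mulₙ u v ≡ oneₙ

Zn' : ∀ {n} → Fin n → Set
Zn' a = toℕ a ≢ 0

One : ∀ {n} → Fin n → Set
One b = toℕ b ≡ 1

WeightedZeroSum : ∀ {n} → (A B : Fin n → Set) → List (Fin n) → Set
WeightedZeroSum {n} A B T =
  Σ (List (Fin n)) λ as → Σ (List (Fin n)) λ bs →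
    length as ≡ length T × length bs ≡ length T ×
    All A as × All B bs ×
    n ∣ sum (zipWith (λ a x → toℕ a * toℕ x) as T) ×
    n ∣ sum (zipWith (λ b a → toℕ b * toℕ a) bs as)

HasWZSSubseq : ∀ {n} → (A B : Fin n → Set) → List (Fin n) → Set
HasWZSSubseq {n} A B S =
  Σ (List (Fin n)) λ T → T ⊆ S × T ≢ [] × WeightedZeroSum A B T

DProp : ∀ (n : ℕ) → (A B : Fin n → Set) → ℕ → Set
DProp n A B k = (S : List (Fin n)) → length S ≡ k → HasWZSSubseq A B S

IsD : ∀ (n : ℕ) → (A B : Fin n → Set) → ℕ → Set
IsD n A B k = 1 ≤ k × DProp n A B k × ((j : ℕ) → 1 ≤ j → j < k → ¬ DProp n A B j)

DExtremal : ∀ {n} → (A B : Fin n → Set) → List (Fin n) → Set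
DExtremal {n} A B S =
  Σ ℕ λ D → IsD n A B D × suc (length S) ≡ D × ¬ HasWZSSubseq A B S

IsTranslateOf : ∀ {n} .{{_ : NonZero n}} → List (Fin n) → List (Fin n) → Set
IsTranslateOf {n} S T = Σ (Fin n) λ x → S ≡ map (λ t → addₙ t x) T

Equivalent : ∀ {n} .{{_ : NonZero n}} → List (Fin n) → List (Fin n) → Set
Equivalent {n} X Y = Σ (Fin n) λ u → IsUnit u × (map (mulₙ u) X ↭ Y)

-- A weighting (a₁, …, a_k) of nonzero residues with Σ aᵢ = 0 is invariant under
-- translating the sequence, so a pair (x, y) has a weighted zero-sum exactly when
-- a·(y − x) = 0 for some a ≠ 0, i.e. when y − x is not a unit. Three terms always
-- admit one: two equal terms give (1, −1), and for distinct terms the weights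
-- (y₂, −y₁, y₁ − y₂), where yᵢ = xᵢ − x₃, work. Hence D = 3, the D-extremal sequences
-- are the pairs with unit difference d, and these are the translates (x, x + d)
-- of (0, d), which d⁻¹ carries to (0, 1).
module Submission where

open import Defs
open import Data.Nat using (ℕ; zero; suc; _+_; _*_; _∸_; _≤_; _<_; NonZero; s≤s; z≤n; >-nonZero⁻¹; ≢-nonZero⁻¹)
open import Data.Nat.Properties
  using ( +-identityʳ; +-assoc; +-comm; *-zeroʳ; *-identityˡ; *-identityʳ; *-distribˡ-+
        ; <⇒≤; ≤-trans; ≤∧≢⇒<; n≢0⇒n>0; m<m*n; m+[n∸m]≡n; <-cmp; suc-injective )
open import Data.Nat.DivMod using (_%_; m%n<n; m%n%n≡m%n; n%n≡0; m<n⇒m%n≡m; %-distribˡ-+; %-distribˡ-*)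
open import Data.Nat.Divisibility using (_∣_; divides; n∣m⇒m%n≡0; m%n≡0⇒n∣m)
open import Data.Nat.GCD using (gcd; gcd[m,n]∣m; gcd[m,n]∣n; gcd[m,n]≢0; module Bézout)
open import Data.Nat.Coprimality using (coprime?; coprime-Bézout; gcd≡1⇒coprime)
open import Data.Nat.ListAction using (sum)
open import Data.Nat.Tactic.RingSolver using (solve-∀)
open import Data.Fin using (Fin; toℕ; fromℕ<) renaming (_≟_ to _≟ᶠ_)
open import Data.Fin.Properties using (toℕ-fromℕ<; toℕ<n; toℕ-injective)
open import Data.List using (List; []; _∷_; length; map; zipWith; replicate)
open import Data.List.Properties using (length-map; length-replicate; zipWith-map)
open import Data.List.Membership.Propositional using (_∈_)
open import Data.List.Relation.Unary.Any using (here; there)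
open import Data.List.Relation.Unary.All using (All; []; _∷_)
import Data.List.Relation.Unary.All as All
open import Data.List.Relation.Unary.All.Properties using (map⁺; replicate⁺)
open import Data.List.Relation.Binary.Sublist.Propositional using (_⊆_; []; _∷_; _∷ʳ_; ⊆-refl; ⊆-trans)
open import Data.List.Relation.Binary.Permutation.Propositional using (_↭_; ↭-reflexive; ↭-sym)
open import Data.List.Relation.Binary.Permutation.Propositional.Properties using (↭-length; ∈-resp-↭)
open import Data.Product using (Σ; _×_; _,_)
open import Data.Sum using (_⊎_; inj₁; inj₂)
open import Data.Empty using (⊥-elim)
open import Function using (_∘_)
open import Function.Bundles using (_⇔_; mk⇔; Equivalence)
import Function.Properties.Equivalence as ⇔
open import Level using (0ℓ)
open import Relation.Binary using (Rel; Setoid; tri<; tri≈; tri>)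
import Relation.Binary.Construct.On as On
open import Relation.Binary.PropositionalEquality
open import Relation.Nullary using (¬_; yes; no; contradiction)
import Relation.Binary.Reasoning.Setoid as SetoidReasoning

module Congruence (n : ℕ) .{{_ : NonZero n}} where

  infix 4 _≋_
  _≋_ : Rel ℕ 0ℓ
  a ≋ b = a % n ≡ b % n

  ≋-setoid : Setoid 0ℓ 0ℓ
  ≋-setoid = On.setoid (setoid ℕ) (_% n)

  open Setoid ≋-setoid public using () renaming (sym to ≋-sym; trans to ≋-trans)
  module ≋-Reasoning = SetoidReasoning ≋-setoid

  ≡⇒≋ : ∀ {a b} → a ≡ b → a ≋ b
  ≡⇒≋ = cong (_% n)

  %-≋ : ∀ a → a % n ≋ a
  %-≋ a = m%n%n≡m%n a n

  0%n≡0 : 0 % n ≡ 0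
  0%n≡0 = m<n⇒m%n≡m (>-nonZero⁻¹ n)

  n≋0 : n ≋ 0
  n≋0 = trans (n%n≡0 n) (sym 0%n≡0)

  ≋0⇒∣ : ∀ {a} → a ≋ 0 → n ∣ a
  ≋0⇒∣ {a} a≋0 = m%n≡0⇒n∣m a n (trans a≋0 0%n≡0)

  ∣⇒≋0 : ∀ {a} → n ∣ a → a ≋ 0
  ∣⇒≋0 {a} n∣a = trans (n∣m⇒m%n≡0 a n n∣a) (sym 0%n≡0)

  ≋⇒≡ : ∀ {a b} → a < n → b < n → a ≋ b → a ≡ b
  ≋⇒≡ a<n b<n a≋b = trans (sym (m<n⇒m%n≡m a<n)) (trans a≋b (m<n⇒m%n≡m b<n))

  +-cong : ∀ {a b c d} → a ≋ b → c ≋ d → a + c ≋ b + d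
  +-cong {a} {b} {c} {d} a≋b c≋d =
    trans (%-distribˡ-+ a c n) (trans (cong₂ (λ x y → (x + y) % n) a≋b c≋d) (sym (%-distribˡ-+ b d n)))

  *-cong : ∀ {a b c d} → a ≋ b → c ≋ d → a * c ≋ b * d
  *-cong {a} {b} {c} {d} a≋b c≋d =
    trans (%-distribˡ-* a c n) (trans (cong₂ (λ x y → (x * y) % n) a≋b c≋d) (sym (%-distribˡ-* b d n)))

  +-congˡ : ∀ a {b c} → b ≋ c → a + b ≋ a + c
  +-congˡ a = +-cong {a} {a} refl

  +-congʳ : ∀ c {a b} → a ≋ b → a + c ≋ b + c
  +-congʳ c a≋b = +-cong a≋b (refl {x = c % n})

  *-congˡ : ∀ a {b c} → b ≋ c → a * b ≋ a * c
  *-congˡ a = *-cong {a} {a} refl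

  *-congʳ : ∀ c {a b} → a ≋ b → a * c ≋ b * c
  *-congʳ c a≋b = *-cong a≋b (refl {x = c % n})

  *-≋0 : ∀ a {b} → b ≋ 0 → a * b ≋ 0
  *-≋0 a b≋0 = ≋-trans (*-congˡ a b≋0) (≡⇒≋ (*-zeroʳ a))

  -- a ⊖ b represents a − b modulo n; unlike a ∸ b it never truncates.
  neg : ℕ → ℕ
  neg a = n ∸ a % n

  infixl 6 _⊖_
  _⊖_ : ℕ → ℕ → ℕ
  a ⊖ b = a + neg b

  +-neg : ∀ a → a + neg a ≋ 0
  +-neg a = begin
    a + neg a            ≈⟨ +-congʳ (neg a) (≋-sym (%-≋ a)) ⟩
    a % n + (n ∸ a % n)  ≡⟨ m+[n∸m]≡n (<⇒≤ (m%n<n a n)) ⟩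
    n                    ≈⟨ n≋0 ⟩
    0                    ∎
    where open ≋-Reasoning

  ⊖-+ : ∀ a b → a ⊖ b + b ≋ a
  ⊖-+ a b = begin
    a + neg b + b    ≡⟨ trans (+-assoc a (neg b) b) (cong (a +_) (+-comm (neg b) b)) ⟩
    a + (b + neg b)  ≈⟨ +-congˡ a (+-neg b) ⟩
    a + 0            ≡⟨ +-identityʳ a ⟩
    a                ∎
    where open ≋-Reasoning

  +-⊖ : ∀ a b → a + b ⊖ b ≋ a
  +-⊖ a b = begin
    a + b + neg b    ≡⟨ +-assoc a b (neg b) ⟩
    a + (b + neg b)  ≈⟨ +-congˡ a (+-neg b) ⟩
    a + 0            ≡⟨ +-identityʳ a ⟩
    a                ∎
    where open ≋-Reasoning

  +-cancelʳ : ∀ c {a b} → a + c ≋ b + c → a ≋ b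
  +-cancelʳ c {a} {b} a+c≋b+c = begin
    a              ≈⟨ ≋-sym (+-⊖ a c) ⟩
    a + c + neg c  ≈⟨ +-congʳ (neg c) a+c≋b+c ⟩
    b + c + neg c  ≈⟨ +-⊖ b c ⟩
    b              ∎
    where open ≋-Reasoning

  ⊖-cancelʳ : ∀ c {a b} → a ⊖ c ≋ b ⊖ c → a ≋ b
  ⊖-cancelʳ c {a} {b} e = begin
    a          ≈⟨ ≋-sym (⊖-+ a c) ⟩
    a ⊖ c + c  ≈⟨ +-congʳ c e ⟩
    b ⊖ c + c  ≈⟨ ⊖-+ b c ⟩
    b          ∎
    where open ≋-Reasoning

  ⊖≋0⇒≋ : ∀ {a b} → a ⊖ b ≋ 0 → a ≋ b
  ⊖≋0⇒≋ {a} {b} a⊖b≋0 = ⊖-cancelʳ b (≋-trans a⊖b≋0 (≋-sym (+-neg b)))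

  neg≋0⇒≋0 : ∀ {a} → neg a ≋ 0 → a ≋ 0
  neg≋0⇒≋0 = ≋-sym ∘ ⊖≋0⇒≋ {0}

  *-⊖≋0 : ∀ a x y → a * (y ⊖ x) ≋ 0 → a * y ≋ a * x
  *-⊖≋0 a x y a[y-x]≋0 = begin
    a * y                ≈⟨ *-congˡ a (≋-sym (⊖-+ y x)) ⟩
    a * (y ⊖ x + x)      ≡⟨ *-distribˡ-+ a (y ⊖ x) x ⟩
    a * (y ⊖ x) + a * x  ≈⟨ +-congʳ (a * x) a[y-x]≋0 ⟩
    a * x                ∎
    where open ≋-Reasoning

  pair-∈-≋ : ∀ {A : Set} (f : A → ℕ) {p q x y} →
             f p ≋ f q → x ∈ p ∷ q ∷ [] → y ∈ p ∷ q ∷ [] → f x ≋ f y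
  pair-∈-≋ f e (here refl)         (here refl)         = refl
  pair-∈-≋ f e (here refl)         (there (here refl)) = e
  pair-∈-≋ f e (there (here refl)) (here refl)         = ≋-sym e
  pair-∈-≋ f e (there (here refl)) (there (here refl)) = refl

  Bézout⇒inverse : ∀ {d} → Bézout.Identity 1 d n → Σ ℕ λ u → u * d ≋ 1
  Bézout⇒inverse {d} (Bézout.+- x y 1+yn≡xd) = x , (begin
    x * d      ≡⟨ sym 1+yn≡xd ⟩
    1 + y * n  ≈⟨ +-congˡ 1 (*-≋0 y n≋0) ⟩
    1          ∎)
    where open ≋-Reasoning
  Bézout⇒inverse {d} (Bézout.-+ x y 1+xd≡yn) = neg x , (begin
    neg x * d                    ≡⟨ sym (+-identityʳ _) ⟩
    neg x * d + 0                ≈⟨ +-congˡ (neg x * d) (≋-sym (≋-trans (≡⇒≋ 1+xd≡yn) (*-≋0 y n≋0))) ⟩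
    neg x * d + (1 + x * d)      ≡⟨ rearrange (neg x) x d ⟩
    (x + neg x) * d + 1          ≈⟨ +-congʳ 1 (*-congʳ d (+-neg x)) ⟩
    1                            ∎)
    where
    open ≋-Reasoning
    rearrange : ∀ m x d → m * d + (1 + x * d) ≡ (x + m) * d + 1
    rearrange = solve-∀

  gcd≢1⇒zeroDivisor : ∀ d → gcd d n ≢ 1 → Σ ℕ λ a → ¬ a ≋ 0 × a * d ≋ 0
  gcd≢1⇒zeroDivisor d g≢1 with gcd[m,n]∣m d n | gcd[m,n]∣n d n
  ... | divides p d≡pg | divides zero n≡0 = contradiction n≡0 (≢-nonZero⁻¹ n)
  ... | divides p d≡pg | divides k@(suc _) n≡kg = k , k≉0 , kd≋0
    where
    g = gcd d n
    1<g : 1 < g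
    1<g = ≤∧≢⇒< (n≢0⇒n>0 (gcd[m,n]≢0 d n (inj₂ (≢-nonZero⁻¹ n)))) (g≢1 ∘ sym)
    k≉0 : ¬ k ≋ 0
    k≉0 k≋0 = contradiction (≋⇒≡ (subst (k <_) (sym n≡kg) (m<m*n k g 1<g)) (>-nonZero⁻¹ n) k≋0) (λ ())
    kd≋0 : k * d ≋ 0
    kd≋0 = begin
      k * d        ≡⟨ cong (k *_) d≡pg ⟩
      k * (p * g)  ≡⟨ swap k p g ⟩
      p * (k * g)  ≡⟨ cong (p *_) (sym n≡kg) ⟩
      p * n        ≈⟨ *-≋0 p n≋0 ⟩
      0            ∎
      where
      open ≋-Reasoning
      swap : ∀ k p g → k * (p * g) ≡ p * (k * g)
      swap = solve-∀

  unit-or-zeroDivisor : ∀ d → (Σ ℕ λ u → u * d ≋ 1) ⊎ (Σ ℕ λ a → ¬ a ≋ 0 × a * d ≋ 0)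
  unit-or-zeroDivisor d with coprime? d n
  ... | yes d⊥n = inj₁ (Bézout⇒inverse (coprime-Bézout d⊥n))
  ... | no ¬d⊥n = inj₂ (gcd≢1⇒zeroDivisor d (¬d⊥n ∘ gcd≡1⇒coprime))

module Weighting (n : ℕ) .{{_ : NonZero n}} where

  open Congruence n

  weightedSum : List ℕ → List ℕ → ℕ
  weightedSum ws xs = sum (zipWith _*_ ws xs)

  record ZeroSumWeighting (xs : List ℕ) : Set where
    constructor weighting
    field
      weights        : List ℕ
      length-weights : length weights ≡ length xs
      nonzero        : All (λ w → ¬ w ≋ 0) weights
      sum≋0          : sum weights ≋ 0
      weightedSum≋0  : weightedSum weights xs ≋ 0

  singleton-weighting : ∀ {x} → ¬ ZeroSumWeighting (x ∷ [])
  singleton-weighting (weighting (w ∷ []) _ (w≉0 ∷ []) w+0≋0 _) =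
    w≉0 (≋-trans (≡⇒≋ (sym (+-identityʳ w))) w+0≋0)

  pair-weighting⇔ : ∀ {x y} → ZeroSumWeighting (x ∷ y ∷ []) ⇔ (Σ ℕ λ a → ¬ a ≋ 0 × a * y ≋ a * x)
  pair-weighting⇔ {x} {y} = mk⇔ to from
    where
    open ≋-Reasoning

    to : ZeroSumWeighting (x ∷ y ∷ []) → Σ ℕ λ a → ¬ a ≋ 0 × a * y ≋ a * x
    to (weighting (a₁ ∷ a₂ ∷ []) _ (_ ∷ a₂≉0 ∷ []) Σa≋0 Σax≋0) = a₂ , a₂≉0 , +-cancelʳ (a₁ * x) (begin
      a₂ * y + a₁ * x          ≡⟨ shuffle a₁ a₂ x y ⟩
      a₁ * x + (a₂ * y + 0)    ≈⟨ Σax≋0 ⟩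
      0                        ≈⟨ ≋-sym (*-congʳ x Σa≋0) ⟩
      (a₁ + (a₂ + 0)) * x      ≡⟨ distribute a₁ a₂ x ⟩
      a₂ * x + a₁ * x          ∎)
      where
      shuffle : ∀ a₁ a₂ x y → a₂ * y + a₁ * x ≡ a₁ * x + (a₂ * y + 0)
      shuffle = solve-∀
      distribute : ∀ a₁ a₂ x → (a₁ + (a₂ + 0)) * x ≡ a₂ * x + a₁ * x
      distribute = solve-∀

    from : (Σ ℕ λ a → ¬ a ≋ 0 × a * y ≋ a * x) → ZeroSumWeighting (x ∷ y ∷ [])
    from (a , a≉0 , ay≋ax) =
      weighting (neg a ∷ a ∷ []) refl ((a≉0 ∘ neg≋0⇒≋0) ∷ a≉0 ∷ []) Σa≋0 Σax≋0
      where
      Σa≋0 : neg a + (a + 0) ≋ 0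
      Σa≋0 = ≋-trans (≡⇒≋ (trans (cong (neg a +_) (+-identityʳ a)) (+-comm (neg a) a))) (+-neg a)
      Σax≋0 : neg a * x + (a * y + 0) ≋ 0
      Σax≋0 = begin
        neg a * x + (a * y + 0)  ≈⟨ +-congˡ (neg a * x) (+-congʳ 0 ay≋ax) ⟩
        neg a * x + (a * x + 0)  ≡⟨ factor (neg a) a x ⟩
        (a + neg a) * x          ≈⟨ *-congʳ x (+-neg a) ⟩
        0                        ∎
        where
        factor : ∀ m a x → m * x + (a * x + 0) ≡ (a + m) * x
        factor = solve-∀

  -- The weights annihilate (y₁, y₂, 0) and sum to 0, so they also annihilate its translate (x₁, x₂, x₃).
  triple-weighting : ∀ {x₁ x₂ x₃} → ¬ x₁ ≋ x₂ → ¬ x₁ ≋ x₃ → ¬ x₂ ≋ x₃ →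
                     ZeroSumWeighting (x₁ ∷ x₂ ∷ x₃ ∷ [])
  triple-weighting {x₁} {x₂} {x₃} x₁≉x₂ x₁≉x₃ x₂≉x₃ =
    weighting (y₂ ∷ neg y₁ ∷ y₁ ⊖ y₂ ∷ []) refl
      ((x₂≉x₃ ∘ ⊖≋0⇒≋) ∷ (x₁≉x₃ ∘ ⊖≋0⇒≋ ∘ neg≋0⇒≋0) ∷ (x₁≉x₂ ∘ ⊖-cancelʳ x₃ ∘ ⊖≋0⇒≋) ∷ [])
      Σa≋0 Σax≋0
    where
    open ≋-Reasoning
    y₁ = x₁ ⊖ x₃
    y₂ = x₂ ⊖ x₃

    Σa≋0 : y₂ + (neg y₁ + (y₁ ⊖ y₂ + 0)) ≋ 0
    Σa≋0 = begin
      y₂ + (neg y₁ + (y₁ + neg y₂ + 0))  ≡⟨ regroup y₁ y₂ (neg y₁) (neg y₂) ⟩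
      (y₁ + neg y₁) + (y₂ + neg y₂)      ≈⟨ +-cong (+-neg y₁) (+-neg y₂) ⟩
      0                                  ∎
      where
      regroup : ∀ a b na nb → b + (na + (a + nb + 0)) ≡ (a + na) + (b + nb)
      regroup = solve-∀

    Σax≋0 : y₂ * x₁ + (neg y₁ * x₂ + ((y₁ ⊖ y₂) * x₃ + 0)) ≋ 0
    Σax≋0 = begin
      y₂ * x₁ + (neg y₁ * x₂ + ((y₁ ⊖ y₂) * x₃ + 0))
        ≈⟨ +-cong (*-congˡ y₂ (≋-sym (⊖-+ x₁ x₃)))
                  (+-congʳ ((y₁ ⊖ y₂) * x₃ + 0) (*-congˡ (neg y₁) (≋-sym (⊖-+ x₂ x₃)))) ⟩
      y₂ * (y₁ + x₃) + (neg y₁ * (y₂ + x₃) + ((y₁ + neg y₂) * x₃ + 0))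
        ≡⟨ regroup y₁ y₂ (neg y₁) (neg y₂) x₃ ⟩
      y₂ * (y₁ + neg y₁) + x₃ * ((y₁ + neg y₁) + (y₂ + neg y₂))
        ≈⟨ +-cong (*-≋0 y₂ (+-neg y₁)) (*-≋0 x₃ (+-cong (+-neg y₁) (+-neg y₂))) ⟩
      0 ∎
      where
      regroup : ∀ a b na nb c →
                b * (a + c) + (na * (b + c) + ((a + nb) * c + 0)) ≡ b * (a + na) + c * ((a + na) + (b + nb))
      regroup = solve-∀

HasWZSSubseq-mono : ∀ {n} {A B : Fin n → Set} {S S′} → S ⊆ S′ → HasWZSSubseq A B S → HasWZSSubseq A B S′
HasWZSSubseq-mono S⊆S′ (T , T⊆S , T≢[] , T-zeroSum) = T , ⊆-trans T⊆S S⊆S′ , T≢[] , T-zeroSum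

IsD-unique : ∀ {n} {A B : Fin n → Set} {k m} → IsD n A B k → IsD n A B m → k ≡ m
IsD-unique {k = k} {m} (1≤k , Dk , k-least) (1≤m , Dm , m-least) with <-cmp k m
... | tri< k<m _ _ = contradiction Dk (m-least k 1≤k k<m)
... | tri≈ _ k≡m _ = k≡m
... | tri> _ _ m<k = contradiction Dm (k-least m 1≤m m<k)

DExtremal⇔ : ∀ {n} {A B : Fin n → Set} {D S} → IsD n A B D →
             DExtremal A B S ⇔ (suc (length S) ≡ D × ¬ HasWZSSubseq A B S)
DExtremal⇔ {D = D} isD = mk⇔
  (λ (D′ , isD′ , ∣S∣<D′ , free) → trans ∣S∣<D′ (IsD-unique isD′ isD) , free)
  (λ (∣S∣<D , free) → D , isD , ∣S∣<D , free)

module ZeroSums (n : ℕ) .{{_ : NonZero n}} (2≤n : 2 ≤ n) where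

  open Congruence n
  open Weighting n

  0ₙ 1ₙ : Fin n
  0ₙ = fromℕ< (≤-trans (s≤s z≤n) 2≤n)
  1ₙ = fromℕ< 2≤n

  TranslateOfEquivalentTo01 : List (Fin n) → Set
  TranslateOfEquivalentTo01 S = Σ (List (Fin n)) λ T → IsTranslateOf S T × Equivalent T (0ₙ ∷ 1ₙ ∷ [])

  residue : ℕ → Fin n
  residue a = fromℕ< (m%n<n a n)

  toℕ-residue : ∀ a → toℕ (residue a) ≋ a
  toℕ-residue a = ≋-trans (≡⇒≋ (toℕ-fromℕ< (m%n<n a n))) (%-≋ a)

  toℕ-≋-injective : ∀ {x y : Fin n} → toℕ x ≋ toℕ y → x ≡ y
  toℕ-≋-injective {x} {y} = toℕ-injective ∘ ≋⇒≡ (toℕ<n x) (toℕ<n y)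

  1≉0 : ¬ 1 ≋ 0
  1≉0 1≋0 = contradiction (≋⇒≡ 2≤n (>-nonZero⁻¹ n) 1≋0) (λ ())

  sum-zipWith-ones : ∀ {bs as : List (Fin n)} → All One bs → length bs ≡ length as →
                     sum (zipWith (λ b a → toℕ b * toℕ a) bs as) ≡ sum (map toℕ as)
  sum-zipWith-ones {[]} {[]} [] _ = refl
  sum-zipWith-ones {b ∷ bs} {a ∷ as} (b≡1 ∷ bs≡1) ∣bs∣≡∣as∣ =
    cong₂ _+_ (trans (cong (_* toℕ a) b≡1) (*-identityˡ (toℕ a))) (sum-zipWith-ones bs≡1 (suc-injective ∣bs∣≡∣as∣))

  sum-residues : ∀ ws → sum (map toℕ (map residue ws)) ≋ sum ws
  sum-residues []       = refl
  sum-residues (w ∷ ws) = +-cong (toℕ-residue w) (sum-residues ws)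

  weightedSum-residues : ∀ ws xs → weightedSum (map toℕ (map residue ws)) xs ≋ weightedSum ws xs
  weightedSum-residues []       xs       = refl
  weightedSum-residues (w ∷ ws) []       = refl
  weightedSum-residues (w ∷ ws) (x ∷ xs) = +-cong (*-congʳ x (toℕ-residue w)) (weightedSum-residues ws xs)

  sum-zipWith-toℕ : ∀ (as T : List (Fin n)) →
                    sum (zipWith (λ a x → toℕ a * toℕ x) as T) ≡ weightedSum (map toℕ as) (map toℕ T)
  sum-zipWith-toℕ as T = cong sum (sym (zipWith-map _*_ toℕ toℕ as T))

  -- With B = {1} the second condition Σ bᵢaᵢ = 0 just says Σ aᵢ = 0.
  weightedZeroSum⇔weighting : ∀ {T} → WeightedZeroSum Zn' One T ⇔ ZeroSumWeighting (map toℕ T)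
  weightedZeroSum⇔weighting {T} = mk⇔ to from
    where
    open ≋-Reasoning

    to : WeightedZeroSum Zn' One T → ZeroSumWeighting (map toℕ T)
    to (as , bs , ∣as∣ , ∣bs∣ , as≢0 , bs≡1 , n∣Σax , n∣Σba) = weighting (map toℕ as)
      (trans (length-map toℕ as) (trans ∣as∣ (sym (length-map toℕ T))))
      (map⁺ (All.map (λ {a} a≢0 → a≢0 ∘ ≋⇒≡ (toℕ<n a) (>-nonZero⁻¹ n)) as≢0))
      (≋-trans (≡⇒≋ (sym (sum-zipWith-ones bs≡1 (trans ∣bs∣ (sym ∣as∣))))) (∣⇒≋0 n∣Σba))
      (≋-trans (≡⇒≋ (sym (sum-zipWith-toℕ as T))) (∣⇒≋0 n∣Σax))

    from : ZeroSumWeighting (map toℕ T) → WeightedZeroSum Zn' One T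
    from (weighting ws ∣ws∣ ws≉0 Σw≋0 Σwx≋0) =
      as , replicate (length T) 1ₙ , ∣as∣ ,
      length-replicate (length T) ,
      map⁺ (All.map (λ w≉0 a≡0 → w≉0 (≋-trans (≋-sym (toℕ-residue _)) (≡⇒≋ a≡0))) ws≉0) ,
      replicate⁺ (length T) (toℕ-fromℕ< 2≤n) ,
      ≋0⇒∣ (begin
        sum (zipWith (λ a x → toℕ a * toℕ x) as T)  ≡⟨ sum-zipWith-toℕ as T ⟩
        weightedSum (map toℕ as) (map toℕ T)        ≈⟨ weightedSum-residues ws (map toℕ T) ⟩
        weightedSum ws (map toℕ T)                  ≈⟨ Σwx≋0 ⟩
        0                                           ∎) ,
      ≋0⇒∣ (begin
        sum (zipWith (λ b a → toℕ b * toℕ a) (replicate (length T) 1ₙ) as)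
          ≡⟨ sum-zipWith-ones (replicate⁺ (length T) (toℕ-fromℕ< 2≤n))
                              (trans (length-replicate (length T)) (sym ∣as∣)) ⟩
        sum (map toℕ as)  ≈⟨ sum-residues ws ⟩
        sum ws            ≈⟨ Σw≋0 ⟩
        0                 ∎)
      where
      as = map residue ws
      ∣as∣ : length as ≡ length T
      ∣as∣ = trans (length-map residue ws) (trans ∣ws∣ (length-map toℕ T))

  toℕ-addₙ : ∀ x y → toℕ (addₙ x y) ≋ toℕ x + toℕ y
  toℕ-addₙ x y = toℕ-residue (toℕ x + toℕ y)

  toℕ-mulₙ : ∀ x y → toℕ (mulₙ x y) ≋ toℕ x * toℕ y
  toℕ-mulₙ x y = toℕ-residue (toℕ x * toℕ y)

  singleton-zeroSumFree : ∀ {s} → ¬ HasWZSSubseq Zn' One (s ∷ [])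
  singleton-zeroSumFree (_ , (_ ∷ʳ []) , T≢[] , _)   = T≢[] refl
  singleton-zeroSumFree (_ , (refl ∷ []) , _ , zs) = singleton-weighting (Equivalence.to weightedZeroSum⇔weighting zs)

  pair-zeroSum⇔ : ∀ {s₁ s₂} →
                  HasWZSSubseq Zn' One (s₁ ∷ s₂ ∷ []) ⇔ (Σ ℕ λ a → ¬ a ≋ 0 × a * toℕ s₂ ≋ a * toℕ s₁)
  pair-zeroSum⇔ {s₁} {s₂} = mk⇔ to from
    where
    to : HasWZSSubseq Zn' One (s₁ ∷ s₂ ∷ []) → Σ ℕ λ a → ¬ a ≋ 0 × a * toℕ s₂ ≋ a * toℕ s₁
    to (_ , (_ ∷ʳ _ ∷ʳ []) , T≢[] , _)    = contradiction refl T≢[]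
    to (T , (_ ∷ʳ T⊆s₂) , T≢[] , zs)    = ⊥-elim (singleton-zeroSumFree (T , T⊆s₂ , T≢[] , zs))
    to (T , (refl ∷ _ ∷ʳ []) , T≢[] , zs) = ⊥-elim (singleton-zeroSumFree (T , ⊆-refl , T≢[] , zs))
    to (_ , (refl ∷ refl ∷ []) , _ , zs)  =
      Equivalence.to pair-weighting⇔ (Equivalence.to weightedZeroSum⇔weighting zs)

    from : (Σ ℕ λ a → ¬ a ≋ 0 × a * toℕ s₂ ≋ a * toℕ s₁) → HasWZSSubseq Zn' One (s₁ ∷ s₂ ∷ [])
    from w = _ , ⊆-refl , (λ ()) , Equivalence.from weightedZeroSum⇔weighting (Equivalence.from pair-weighting⇔ w)

  repeated-zeroSum : ∀ s → HasWZSSubseq Zn' One (s ∷ s ∷ [])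
  repeated-zeroSum s = Equivalence.from pair-zeroSum⇔ (1 , 1≉0 , refl)

  triple-zeroSum : ∀ s₁ s₂ s₃ → HasWZSSubseq Zn' One (s₁ ∷ s₂ ∷ s₃ ∷ [])
  triple-zeroSum s₁ s₂ s₃ with s₁ ≟ᶠ s₂ | s₁ ≟ᶠ s₃ | s₂ ≟ᶠ s₃
  ... | yes refl | _        | _        = HasWZSSubseq-mono (refl ∷ refl ∷ s₃ ∷ʳ []) (repeated-zeroSum s₁)
  ... | no _     | yes refl | _        = HasWZSSubseq-mono (refl ∷ s₂ ∷ʳ refl ∷ []) (repeated-zeroSum s₁)
  ... | no _     | no _     | yes refl = HasWZSSubseq-mono (s₁ ∷ʳ refl ∷ refl ∷ []) (repeated-zeroSum s₂)
  ... | no s₁≢s₂ | no s₁≢s₃ | no s₂≢s₃ =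
    _ , ⊆-refl , (λ ()) , Equivalence.from weightedZeroSum⇔weighting
      (triple-weighting (s₁≢s₂ ∘ toℕ-≋-injective) (s₁≢s₃ ∘ toℕ-≋-injective) (s₂≢s₃ ∘ toℕ-≋-injective))

  01-separated : ∀ {a} → ¬ a ≋ 0 → ¬ a * toℕ 1ₙ ≋ a * toℕ 0ₙ
  01-separated {a} a≉0 a≋0 = a≉0 (begin
    a              ≡⟨ sym (trans (cong (a *_) (toℕ-fromℕ< 2≤n)) (*-identityʳ a)) ⟩
    a * toℕ 1ₙ     ≈⟨ a≋0 ⟩
    a * toℕ 0ₙ     ≡⟨ trans (cong (a *_) (toℕ-fromℕ< _)) (*-zeroʳ a) ⟩
    0              ∎)
    where open ≋-Reasoning

  D≡3 : IsD n Zn' One 3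
  D≡3 = s≤s z≤n , triples , least
    where
    triples : DProp n Zn' One 3
    triples (s₁ ∷ s₂ ∷ s₃ ∷ []) refl = triple-zeroSum s₁ s₂ s₃

    least : (j : ℕ) → 1 ≤ j → j < 3 → ¬ DProp n Zn' One j
    least 1 _ _ D₁ = singleton-zeroSumFree (D₁ (0ₙ ∷ []) refl)
    least 2 _ _ D₂ with Equivalence.to pair-zeroSum⇔ (D₂ (0ₙ ∷ 1ₙ ∷ []) refl)
    ... | a , a≉0 , a≋0 = 01-separated a≉0 a≋0
    least (suc (suc (suc _))) _ (s≤s (s≤s (s≤s ())))

  translateOfEquivalentTo01⇒zeroSumFree : ∀ {s₁ s₂} →
    TranslateOfEquivalentTo01 (s₁ ∷ s₂ ∷ []) → ¬ HasWZSSubseq Zn' One (s₁ ∷ s₂ ∷ [])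
  translateOfEquivalentTo01⇒zeroSumFree (t₁ ∷ t₂ ∷ [] , (x , refl) , u , _ , uT↭01) zs
    with Equivalence.to pair-zeroSum⇔ zs
  ... | a , a≉0 , a[t₂+x]≋a[t₁+x] =
    01-separated a≉0 (pair-∈-≋ (λ w → a * toℕ w) a[ut₁]≋a[ut₂]
      (∈-resp-↭ (↭-sym uT↭01) (there (here refl))) (∈-resp-↭ (↭-sym uT↭01) (here refl)))
    where
    open ≋-Reasoning
    U = toℕ u
    X = toℕ x

    at₁≋at₂ : a * toℕ t₁ ≋ a * toℕ t₂
    at₁≋at₂ = +-cancelʳ (a * X) (begin
      a * toℕ t₁ + a * X   ≡⟨ sym (*-distribˡ-+ a (toℕ t₁) X) ⟩
      a * (toℕ t₁ + X)     ≈⟨ *-congˡ a (≋-sym (toℕ-addₙ t₁ x)) ⟩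
      a * toℕ (addₙ t₁ x)  ≈⟨ ≋-sym a[t₂+x]≋a[t₁+x] ⟩
      a * toℕ (addₙ t₂ x)  ≈⟨ *-congˡ a (toℕ-addₙ t₂ x) ⟩
      a * (toℕ t₂ + X)     ≡⟨ *-distribˡ-+ a (toℕ t₂) X ⟩
      a * toℕ t₂ + a * X   ∎)

    a[ut₁]≋a[ut₂] : a * toℕ (mulₙ u t₁) ≋ a * toℕ (mulₙ u t₂)
    a[ut₁]≋a[ut₂] = begin
      a * toℕ (mulₙ u t₁)  ≈⟨ *-congˡ a (toℕ-mulₙ u t₁) ⟩
      a * (U * toℕ t₁)     ≡⟨ swap a U (toℕ t₁) ⟩
      U * (a * toℕ t₁)     ≈⟨ *-congˡ U at₁≋at₂ ⟩
      U * (a * toℕ t₂)     ≡⟨ sym (swap a U (toℕ t₂)) ⟩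
      a * (U * toℕ t₂)     ≈⟨ *-congˡ a (≋-sym (toℕ-mulₙ u t₂)) ⟩
      a * toℕ (mulₙ u t₂)  ∎
      where
      swap : ∀ a u t → a * (u * t) ≡ u * (a * t)
      swap = solve-∀

  -- The witness: (s₁, s₂) is the translate by s₁ of (0, d), and u = d⁻¹ sends (0, d) to (0, 1).
  unitDifference⇒translateOfEquivalentTo01 : ∀ {s₁ s₂ u} →
    u * (toℕ s₂ ⊖ toℕ s₁) ≋ 1 → TranslateOfEquivalentTo01 (s₁ ∷ s₂ ∷ [])
  unitDifference⇒translateOfEquivalentTo01 {s₁} {s₂} {u} ud≋1 =
    0ₙ ∷ residue d ∷ [] , (s₁ , cong₂ _∷_ s₁≡0+s₁ (cong₂ _∷_ s₂≡d+s₁ refl)) ,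
    residue u , (residue d , toℕ-≋-injective (≋-trans [ud]≋1 (≋-sym (toℕ-residue 1)))) ,
    ↭-reflexive (cong₂ _∷_ u0≡0 (cong₂ _∷_ (toℕ-≋-injective (≋-trans [ud]≋1 (≡⇒≋ (sym toℕ-1ₙ)))) refl))
    where
    open ≋-Reasoning
    d = toℕ s₂ ⊖ toℕ s₁
    toℕ-0ₙ : toℕ 0ₙ ≡ 0
    toℕ-0ₙ = toℕ-fromℕ< _
    toℕ-1ₙ : toℕ 1ₙ ≡ 1
    toℕ-1ₙ = toℕ-fromℕ< 2≤n

    s₁≡0+s₁ : s₁ ≡ addₙ 0ₙ s₁
    s₁≡0+s₁ = toℕ-≋-injective (≋-sym (≋-trans (toℕ-addₙ 0ₙ s₁) (≡⇒≋ (cong (_+ toℕ s₁) toℕ-0ₙ))))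

    s₂≡d+s₁ : s₂ ≡ addₙ (residue d) s₁
    s₂≡d+s₁ = toℕ-≋-injective (≋-sym (begin
      toℕ (addₙ (residue d) s₁)  ≈⟨ toℕ-addₙ (residue d) s₁ ⟩
      toℕ (residue d) + toℕ s₁   ≈⟨ +-congʳ (toℕ s₁) (toℕ-residue d) ⟩
      d + toℕ s₁                 ≈⟨ ⊖-+ (toℕ s₂) (toℕ s₁) ⟩
      toℕ s₂                     ∎))

    [ud]≋1 : toℕ (mulₙ (residue u) (residue d)) ≋ 1
    [ud]≋1 = ≋-trans (toℕ-mulₙ (residue u) (residue d)) (≋-trans (*-cong (toℕ-residue u) (toℕ-residue d)) ud≋1)

    u0≡0 : mulₙ (residue u) 0ₙ ≡ 0ₙ
    u0≡0 = toℕ-≋-injective (≋-trans (toℕ-mulₙ (residue u) 0ₙ)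
             (≡⇒≋ (trans (cong (toℕ (residue u) *_) toℕ-0ₙ) (trans (*-zeroʳ (toℕ (residue u))) (sym toℕ-0ₙ)))))

  pair-zeroSumFree⇔ : ∀ {s₁ s₂} →
    (¬ HasWZSSubseq Zn' One (s₁ ∷ s₂ ∷ [])) ⇔ TranslateOfEquivalentTo01 (s₁ ∷ s₂ ∷ [])
  pair-zeroSumFree⇔ {s₁} {s₂} = mk⇔ to translateOfEquivalentTo01⇒zeroSumFree
    where
    to : ¬ HasWZSSubseq Zn' One (s₁ ∷ s₂ ∷ []) → TranslateOfEquivalentTo01 (s₁ ∷ s₂ ∷ [])
    to free with unit-or-zeroDivisor (toℕ s₂ ⊖ toℕ s₁)
    ... | inj₁ (u , ud≋1)       = unitDifference⇒translateOfEquivalentTo01 {u = u} ud≋1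
    ... | inj₂ (a , a≉0 , ad≋0) = contradiction (Equivalence.from pair-zeroSum⇔ (a , a≉0 , *-⊖≋0 a _ _ ad≋0)) free

  translateOfEquivalentTo01⇒length≡2 : ∀ {S} → TranslateOfEquivalentTo01 S → length S ≡ 2
  translateOfEquivalentTo01⇒length≡2 (T , (x , refl) , u , _ , uT↭01) =
    trans (length-map _ T) (trans (sym (length-map (mulₙ u) T)) (↭-length uT↭01))

  notPair⇔ : ∀ {S} → length S ≢ 2 →
    (suc (length S) ≡ 3 × ¬ HasWZSSubseq Zn' One S) ⇔ TranslateOfEquivalentTo01 S
  notPair⇔ ∣S∣≢2 = mk⇔ (λ (∣S∣+1≡3 , _) → contradiction (suc-injective ∣S∣+1≡3) ∣S∣≢2)
                       (λ te → contradiction (translateOfEquivalentTo01⇒length≡2 te) ∣S∣≢2)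

  extremal-characterisation : ∀ S →
    (suc (length S) ≡ 3 × ¬ HasWZSSubseq Zn' One S) ⇔ TranslateOfEquivalentTo01 S
  extremal-characterisation (s₁ ∷ s₂ ∷ []) =
    mk⇔ (λ (_ , free) → Equivalence.to pair-zeroSumFree⇔ free) (λ te → refl , Equivalence.from pair-zeroSumFree⇔ te)
  extremal-characterisation []              = notPair⇔ (λ ())
  extremal-characterisation (_ ∷ [])        = notPair⇔ (λ ())
  extremal-characterisation (_ ∷ _ ∷ _ ∷ _) = notPair⇔ (λ ())

theorem9 : (n : ℕ) .{{_ : NonZero n}} → (2≤n : 2 ≤ n) → (S : List (Fin n)) →
    DExtremal Zn' One S ⇔
      (Σ (List (Fin n)) λ T → IsTranslateOf S T ×
        Equivalent T (fromℕ< (≤-trans (s≤s z≤n) 2≤n) ∷ fromℕ< 2≤n ∷ []))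
theorem9 n 2≤n S = ⇔.trans (DExtremal⇔ D≡3) (extremal-characterisation S)
  where open ZeroSums n 2≤n
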